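{- Let $\varphi = \forall \pi_1 \cdots \forall \pi_n.\ \psi$ be a universal HyperLTL formula with $\psi$ quantifier-free. Then either $\varphi \equiv \mathit{collapse}(\varphi)$, or there is no HyperLTL formula of the form $\forall \pi.\ \chi$ ($\chi$ quantifier-free) that is equivalent to $\varphi$.
   Context: HyperLTL formulas over a set $\mathrm{AP}$ are built as $\varphi ::= \exists \pi.\varphi \mid \forall \pi.\varphi \mid \psi$ and $\psi ::= a_\pi \mid \neg\psi \mid \psi\lor\psi \mid \mathsf{X}\psi \mid \psi\,\mathsf{U}\,\psi$ with $a \in \mathrm{AP}$ and trace variables $\pi$. A set of traces $T \subseteq (2^{\mathrm{AP}})^\omega$ satisfies a formula under the standard semantics where quantifiers range over traces in $T$. Two formulas are equivalent ($\equiv$) if they are satisfied by exactly the same sets of traces. For $\varphi = \forall \pi_1 \cdots \forall \pi_n.\ \psi$, $\mathit{collapse}(\varphi) := \forall \pi.\ \psi[\pi_1 \mapsto \pi]\cdots[\pi_n\mapsto\pi]$, where $\psi[\pi_i\mapsto\pi]$ replaces every occurrence of the trace variable $\pi_i$ in $\psi$ by a fresh variable $\pi$. -}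

module Defs where

open import Data.Nat using (ℕ; zero; suc; _+_; _≤_; _<_)
open import Data.Fin using (Fin; zero; suc)
open import Data.Bool using (Bool; true)
open import Data.Product using (Σ; _×_)
open import Relation.Binary.PropositionalEquality using (_≡_)
open import Function.Bundles using (_⇔_)

module _ (AP : Set) where

  Trace : Set
  Trace = ℕ → AP → Bool

  TraceSet : Set₁
  TraceSet = Trace → Set

  -- Quantifier-free HyperLTL body with n trace variables in scope
  -- (de Bruijn: Fin n names the trace variables).
  data QF (n : ℕ) : Set where
    atom  : AP → Fin n → QF n
    ¬'_   : QF n → QF n
    _∨'_  : QF n → QF n → QF n
    X'_   : QF n → QF n
    _U'_  : QF n → QF n → QF n

  data HyperLTL (n : ℕ) : Set where
    ∃'_ : HyperLTL (suc n) → HyperLTL n   -- ∃ π. φ  (π is variable zero)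
    ∀'_ : HyperLTL (suc n) → HyperLTL n
    body : QF n → HyperLTL n

  Assignment : ℕ → Set
  Assignment n = Fin n → Trace

  extend : ∀ {n} → Trace → Assignment n → Assignment (suc n)
  extend t Π zero    = t
  extend t Π (suc i) = Π i

  ⟦_⟧qf : ∀ {n} → QF n → Assignment n → ℕ → Set
  ⟦ atom a x ⟧qf Π i = Π x i a ≡ true
  ⟦ ¬' ψ ⟧qf Π i = ⟦ ψ ⟧qf Π i → Data.Empty.⊥
    where import Data.Empty
  ⟦ ψ₁ ∨' ψ₂ ⟧qf Π i = ⟦ ψ₁ ⟧qf Π i Data.Sum.⊎ ⟦ ψ₂ ⟧qf Π i
    where import Data.Sum
  ⟦ X' ψ ⟧qf Π i = ⟦ ψ ⟧qf Π (suc i)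
  ⟦ ψ₁ U' ψ₂ ⟧qf Π i =
    Σ ℕ (λ j → (i ≤ j) × (⟦ ψ₂ ⟧qf Π j × ((k : ℕ) → i ≤ k → k < j → ⟦ ψ₁ ⟧qf Π k)))

  ⟦_⟧ : ∀ {n} → HyperLTL n → TraceSet → Assignment n → Set
  ⟦ ∃' φ ⟧ T Π = Σ Trace (λ t → T t × ⟦ φ ⟧ T (extend t Π))
  ⟦ ∀' φ ⟧ T Π = (t : Trace) → T t → ⟦ φ ⟧ T (extend t Π)
  ⟦ body ψ ⟧ T Π = ⟦ ψ ⟧qf Π 0

  noTraces : Assignment 0
  noTraces ()

  _⊨_ : TraceSet → HyperLTL 0 → Set
  T ⊨ φ = ⟦ φ ⟧ T noTraces

  _≡H_ : HyperLTL 0 → HyperLTL 0 → Set₁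
  φ ≡H φ′ = (T : TraceSet) → (T ⊨ φ) ⇔ (T ⊨ φ′)

  forallAll : ∀ {n} → HyperLTL n → HyperLTL 0
  forallAll {zero} φ = φ
  forallAll {suc n} φ = forallAll (∀' φ)

  universal : (n : ℕ) → QF n → HyperLTL 0
  universal n ψ = forallAll (body ψ)

  rename : ∀ {n m} → (Fin n → Fin m) → QF n → QF m
  rename ρ (atom a x) = atom a (ρ x)
  rename ρ (¬' ψ) = ¬' rename ρ ψ
  rename ρ (ψ₁ ∨' ψ₂) = rename ρ ψ₁ ∨' rename ρ ψ₂
  rename ρ (X' ψ) = X' rename ρ ψ
  rename ρ (ψ₁ U' ψ₂) = rename ρ ψ₁ U' rename ρ ψ₂

  collapse : (n : ℕ) → QF n → HyperLTL 0
  collapse n ψ = ∀' body (rename (λ _ → zero) ψ)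

module Submission where

-- Call a closed formula φ *singleton-determined* if, for every
-- set of traces T, T ⊨ φ holds exactly when {t} ⊨ φ for every t ∈ T.
-- Every formula ∀π. χ with χ quantifier-free is singleton-determined, since
-- its single quantifier only ever looks at one trace at a time; being
-- singleton-determined is invariant under ≡H; and two singleton-determined
-- formulas that agree on all singletons are equivalent.  On a singleton {t}
-- both ∀π₁⋯∀πₙ. ψ and collapse(∀π₁⋯∀πₙ. ψ) hold iff ψ holds when every trace
-- variable is bound to t.  Hence if ∀π₁⋯∀πₙ. ψ ≡ ∀π. χ for some χ, then it
-- is singleton-determined and so equivalent to its collapse.

open import Defs
open import Data.Nat using (ℕ; zero; suc)
open import Data.Fin using (Fin; zero; suc)
open import Data.Product using (Σ; _,_)
open import Data.Sum using (inj₁; inj₂)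
open import Data.Sum.Function.Propositional using (_⊎-⇔_)
open import Relation.Binary.PropositionalEquality using (_≡_; refl; sym; subst)
open import Function.Bundles using (_⇔_; mk⇔; Equivalence)
open import Function.Construct.Composition using (_⇔-∘_)
open import Function.Construct.Symmetry using (⇔-sym)
open import Function.Related.TypeIsomorphisms using (¬-cong-⇔)

open Equivalence using (to; from)

module _ {AP : Set} where

  _≗A_ : ∀ {n} → Assignment AP n → Assignment AP n → Set
  _≗A_ {n} Π Π′ = (x : Fin n) → Π x ≡ Π′ x

  -- Needed for the contravariant (negation) case of qf-cong.
  ≗A-sym : ∀ {n} {Π Π′ : Assignment AP n} → Π ≗A Π′ → Π′ ≗A Π
  ≗A-sym e x = sym (e x)

  extend-≗A : ∀ {n} (t : Trace AP) {Π Π′ : Assignment AP n}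
            → Π ≗A Π′ → extend AP t Π ≗A extend AP t Π′
  extend-≗A t e zero    = refl
  extend-≗A t e (suc x) = e x

  -- The semantics only depends on the traces the assignment binds
  -- (we have no function extensionality, so this must be proved).
  qf-cong : ∀ {n} (ψ : QF AP n) {Π Π′ : Assignment AP n} → Π ≗A Π′
          → ∀ i → ⟦_⟧qf AP ψ Π i → ⟦_⟧qf AP ψ Π′ i
  qf-cong (atom a x)  e i h = subst (λ t → t i a ≡ _) (e x) h
  qf-cong (¬' ψ)      e i h p = h (qf-cong ψ (≗A-sym e) i p)
  qf-cong (ψ₁ ∨' ψ₂)  e i (inj₁ p) = inj₁ (qf-cong ψ₁ e i p)
  qf-cong (ψ₁ ∨' ψ₂)  e i (inj₂ p) = inj₂ (qf-cong ψ₂ e i p)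
  qf-cong (X' ψ)      e i h = qf-cong ψ e (suc i) h
  qf-cong (ψ₁ U' ψ₂)  e i (j , i≤j , now , before) =
    j , i≤j , qf-cong ψ₂ e j now , λ k i≤k k<j → qf-cong ψ₁ e k (before k i≤k k<j)

  sat-cong : ∀ {n} (φ : HyperLTL AP n) (T : TraceSet AP) {Π Π′ : Assignment AP n}
           → Π ≗A Π′ → ⟦_⟧ AP φ T Π → ⟦_⟧ AP φ T Π′
  sat-cong (∃' φ)   T e (t , t∈T , h) = t , t∈T , sat-cong φ T (extend-≗A t e) h
  sat-cong (∀' φ)   T e h t t∈T      = sat-cong φ T (extend-≗A t e) (h t t∈T)
  sat-cong (body ψ) T e h            = qf-cong ψ e 0 h

  _∈ₐ_ : ∀ {n} → Assignment AP n → TraceSet AP → Set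
  _∈ₐ_ {n} Π T = (x : Fin n) → T (Π x)

  forallAll-sound : ∀ n (φ : HyperLTL AP n) (T : TraceSet AP)
                  → _⊨_ AP T (forallAll AP φ)
                  → (Π : Assignment AP n) → Π ∈ₐ T → ⟦_⟧ AP φ T Π
  forallAll-sound zero    φ T h Π Π∈T = sat-cong φ T (λ ()) h
  forallAll-sound (suc n) φ T h Π Π∈T =
    sat-cong φ T head∷tail
      (forallAll-sound n (∀' φ) T h (λ x → Π (suc x)) (λ x → Π∈T (suc x))
                       (Π zero) (Π∈T zero))
    where
    head∷tail : extend AP (Π zero) (λ x → Π (suc x)) ≗A Π
    head∷tail zero    = refl
    head∷tail (suc x) = refl

  forallAll-complete : ∀ n (φ : HyperLTL AP n) (T : TraceSet AP)
                     → ((Π : Assignment AP n) → Π ∈ₐ T → ⟦_⟧ AP φ T Π)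
                     → _⊨_ AP T (forallAll AP φ)
  forallAll-complete zero    φ T h = h (noTraces AP) (λ ())
  forallAll-complete (suc n) φ T h =
    forallAll-complete n (∀' φ) T (λ Π Π∈T t t∈T → h (extend AP t Π) (extend-∈ₐ Π∈T t∈T))
    where
    extend-∈ₐ : ∀ {Π t} → Π ∈ₐ T → T t → extend AP t Π ∈ₐ T
    extend-∈ₐ Π∈T t∈T zero    = t∈T
    extend-∈ₐ Π∈T t∈T (suc x) = Π∈T x

  rename-sem : ∀ {n m} (ρ : Fin n → Fin m) (ψ : QF AP n) (Π : Assignment AP m) i
             → ⟦_⟧qf AP (rename AP ρ ψ) Π i ⇔ ⟦_⟧qf AP ψ (λ x → Π (ρ x)) i
  rename-sem ρ (atom a x) Π i = mk⇔ (λ h → h) (λ h → h)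
  rename-sem ρ (¬' ψ)     Π i = ¬-cong-⇔ (rename-sem ρ ψ Π i)
  rename-sem ρ (ψ₁ ∨' ψ₂) Π i = rename-sem ρ ψ₁ Π i ⊎-⇔ rename-sem ρ ψ₂ Π i
  rename-sem ρ (X' ψ)     Π i = rename-sem ρ ψ Π (suc i)
  rename-sem ρ (ψ₁ U' ψ₂) Π i = mk⇔
    (λ { (j , i≤j , now , before) →
           j , i≤j , to (ρψ₂ j) now , λ k i≤k k<j → to (ρψ₁ k) (before k i≤k k<j) })
    (λ { (j , i≤j , now , before) →
           j , i≤j , from (ρψ₂ j) now , λ k i≤k k<j → from (ρψ₁ k) (before k i≤k k<j) })
    where
    ρψ₁ : ∀ k → ⟦_⟧qf AP (rename AP ρ ψ₁) Π k ⇔ ⟦_⟧qf AP ψ₁ (λ x → Π (ρ x)) k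
    ρψ₁ = rename-sem ρ ψ₁ Π
    ρψ₂ : ∀ k → ⟦_⟧qf AP (rename AP ρ ψ₂) Π k ⇔ ⟦_⟧qf AP ψ₂ (λ x → Π (ρ x)) k
    ρψ₂ = rename-sem ρ ψ₂ Π

  ｛_｝ : Trace AP → TraceSet AP
  ｛ t ｝ s = s ≡ t

  everywhere : ∀ {n} → Trace AP → Assignment AP n
  everywhere t _ = t

  universal-on-singleton : ∀ n (ψ : QF AP n) (t : Trace AP)
    → _⊨_ AP ｛ t ｝ (universal AP n ψ) ⇔ ⟦_⟧qf AP ψ (everywhere t) 0
  universal-on-singleton n ψ t = mk⇔
    (λ h → forallAll-sound n (body ψ) ｛ t ｝ h (everywhere t) (λ _ → refl))
    (λ ψt → forallAll-complete n (body ψ) ｛ t ｝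
               (λ Π Π∈｛t｝ → qf-cong ψ (≗A-sym Π∈｛t｝) 0 ψt))

  collapse-on-singleton : ∀ n (ψ : QF AP n) (t : Trace AP)
    → _⊨_ AP ｛ t ｝ (collapse AP n ψ) ⇔ ⟦_⟧qf AP ψ (everywhere t) 0
  collapse-on-singleton n ψ t = mk⇔
    (λ h → to collapsed (h t refl))
    (λ ψt → λ { s refl → from collapsed ψt })
    where
    -- collapse binds its single variable to t, i.e. every πᵢ to t
    collapsed : ⟦_⟧qf AP (rename AP (λ _ → zero) ψ) (extend AP t (noTraces AP)) 0
              ⇔ ⟦_⟧qf AP ψ (everywhere t) 0
    collapsed = rename-sem (λ _ → zero) ψ (extend AP t (noTraces AP)) 0

  SingletonDetermined : HyperLTL AP 0 → Set₁
  SingletonDetermined φ = (T : TraceSet AP)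
    → _⊨_ AP T φ ⇔ ((t : Trace AP) → T t → _⊨_ AP ｛ t ｝ φ)

  -- A single universal quantifier only inspects one trace at a time.
  ∀body-determined : (χ : QF AP 1) → SingletonDetermined (∀' body χ)
  ∀body-determined χ T = mk⇔
    (λ h t t∈T → λ { s refl → h t t∈T })
    (λ h t t∈T → h t t∈T t refl)

  ≡H-determined : ∀ φ φ′ → _≡H_ AP φ φ′
                → SingletonDetermined φ′ → SingletonDetermined φ
  ≡H-determined φ φ′ φ≡φ′ det T = mk⇔
    (λ h t t∈T → from (φ≡φ′ ｛ t ｝) (to (det T) (to (φ≡φ′ T) h) t t∈T))
    (λ h → from (φ≡φ′ T) (from (det T) (λ t t∈T → to (φ≡φ′ ｛ t ｝) (h t t∈T))))

  determined-by-singletons : ∀ φ φ′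
    → SingletonDetermined φ → SingletonDetermined φ′
    → ((t : Trace AP) → _⊨_ AP ｛ t ｝ φ ⇔ _⊨_ AP ｛ t ｝ φ′)
    → _≡H_ AP φ φ′
  determined-by-singletons φ φ′ det det′ agree T = mk⇔
    (λ h → from (det′ T) (λ t t∈T → to (agree t) (to (det T) h t t∈T)))
    (λ h → from (det T) (λ t t∈T → from (agree t) (to (det′ T) h t t∈T)))

mainTheorem5 : (AP : Set) (n : ℕ) (ψ : QF AP n)
    → Σ (QF AP 1) (λ χ → _≡H_ AP (universal AP n ψ) (∀' body χ))
    → _≡H_ AP (universal AP n ψ) (collapse AP n ψ)
mainTheorem5 AP n ψ (χ , φ≡∀χ) =
  determined-by-singletons (universal AP n ψ) (collapse AP n ψ)
    (≡H-determined (universal AP n ψ) (∀' body χ) φ≡∀χ (∀body-determined χ))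
    (∀body-determined (rename AP (λ _ → zero) ψ))
    (λ t → ⇔-sym (collapse-on-singleton n ψ t) ⇔-∘ universal-on-singleton n ψ t)
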